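{- Let $L$ be a locale, $S$ a subset of $L$, and $\mathcal F=\{f_i\}_{i\in I}$ a (possibly empty) set-indexed family of continuous maps $f_i:L\to L_i$ with each $L_i$ compact and regular; for each $i$ let $B_i$ be a set of generators (basis) of $L_i$ that is a sub-pcd-lattice of $L_i$. Let $S_{\mathcal F}=S\cup\{f_i^-(b):i\in I,b\in B_i\}$. Then the relation $\lhd_{\mathcal F}\subseteq S_{\mathcal F}^*\times S_{\mathcal F}^*$ defined inductively as the least relation containing $\{(f_i^-(b),f_i^-(a)):i\in I,\ a,b\in B_i,\ b\prec a\}$ and closed under conditions (1)–(5) below is a strong inclusion on $S_{\mathcal F}^*$.
   Context: Framework: constructive set theory CZF + RRS-$\bigcup$REA (intuitionistic logic, no Powerset, Restricted Separation only). A locale $(L,B)$ is a class-frame (finite meets, set-indexed joins, infinite distributivity) with a set basis $B$ such that every $x$ is the join of the set $\{b\in B:b\le x\}$. $y^*=\bigvee\{c\in B:c\wedge y=0\}$; $y\prec x$ iff $1=x\vee y^*$. Regular: $a=\bigvee\{b\in B:b\prec a\}$ for $a\in B$; compact: every subset of $B$ with join $1$ has a finite subset with join $1$. A continuous map $f:L\to M$ is a function $f^-:B_M\to L$ preserving the top, binary meets in the form $f^-(a)\wedge f^-(b)=\bigvee\{f^-(c):c\in B_M,c\le a,c\le b\}$, and covers. For a subset $S$ of a locale, $S^*$ is the least subset containing $S$ closed under $^*$ and finite meets and joins; a sub-pcd-lattice is a set closed under these operations. Conditions: (1) $0\lhd0$, $1\lhd1$; (2) $x\le a\lhd b\le y\Rightarrow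 x\lhd y$; (3) $x\lhd a,x\lhd b\Rightarrow x\lhd a\wedge b$; (4) $x\lhd a,y\lhd a\Rightarrow x\vee y\lhd a$; (5) $a\lhd b\Rightarrow b^*\lhd a^*$. A strong inclusion on a pcd-lattice $P$ is a set-relation satisfying (1)–(5) together with (6) $\lhd\subseteq\prec$ and (7) $x\lhd y\Rightarrow x\lhd z\lhd y$ for some $z\in P$. -}

module Defs where

open import Level using (Level; 0ℓ) renaming (suc to lsuc)
open import Data.Empty using (⊥)
open import Data.Bool using (Bool; true; false)
open import Data.Nat using (ℕ)
open import Data.Fin using (Fin)
open import Data.Product using (Σ; Σ-syntax; _×_; _,_; proj₁)

-- Locales (class-frames with a set basis).
-- Sets are modelled by types in Set (= Set₀), classes by types in Set₁.
-- The order is primitive; equality of elements is x ≤ y × y ≤ x.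

record Locale : Set₂ where
  infix 4 _≤_
  infixr 7 _∧_
  field
    Carrier : Set₁
    _≤_     : Carrier → Carrier → Set
    ≤-refl  : ∀ {x} → x ≤ x
    ≤-trans : ∀ {x y z} → x ≤ y → y ≤ z → x ≤ z
    ⊤       : Carrier
    ⊤-max   : ∀ {x} → x ≤ ⊤
    _∧_     : Carrier → Carrier → Carrier
    ∧-lb₁   : ∀ {x y} → x ∧ y ≤ x
    ∧-lb₂   : ∀ {x y} → x ∧ y ≤ y
    ∧-glb   : ∀ {z x y} → z ≤ x → z ≤ y → z ≤ x ∧ y
    ⋁       : (I : Set) → (I → Carrier) → Carrier
    ⋁-ub    : ∀ {I} (f : I → Carrier) (i : I) → f i ≤ ⋁ I f
    ⋁-lub   : ∀ {I} (f : I → Carrier) {x} → (∀ i → f i ≤ x) → ⋁ I f ≤ x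
    distrib : ∀ x {I} (f : I → Carrier) → x ∧ ⋁ I f ≤ ⋁ I (λ i → x ∧ f i)
    Basis   : Set
    ι       : Basis → Carrier
    basis   : ∀ x → x ≤ ⋁ (Σ Basis (λ b → ι b ≤ x)) (λ p → ι (proj₁ p))

  infix 4 _≈_ _≺_
  infixr 6 _∨_

  _≈_ : Carrier → Carrier → Set
  x ≈ y = (x ≤ y) × (y ≤ x)

  𝟘 : Carrier
  𝟘 = ⋁ ⊥ (λ ())

  _∨_ : Carrier → Carrier → Carrier
  x ∨ y = ⋁ Bool (λ { true → x ; false → y })

  _* : Carrier → Carrier
  y * = ⋁ (Σ Basis (λ c → ι c ∧ y ≈ 𝟘)) (λ p → ι (proj₁ p))

  _≺_ : Carrier → Carrier → Set
  y ≺ x = ⊤ ≈ x ∨ (y *)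

  IsRegular : Set
  IsRegular = ∀ a → ι a ≈ ⋁ (Σ Basis (λ b → ι b ≺ ι a)) (λ p → ι (proj₁ p))

  -- every subset of B (given as a set-indexed family) with join 1 has a
  -- finite subset (a finite list of its members) with join 1
  IsCompact : Set₁
  IsCompact = ∀ (U : Set) (u : U → Basis) → ⊤ ≈ ⋁ U (λ k → ι (u k)) →
              Σ ℕ (λ n → Σ (Fin n → U) (λ e → ⊤ ≈ ⋁ (Fin n) (λ j → ι (u (e j)))))

  BasisIsSubPcd : Set
  BasisIsSubPcd =
    Σ Basis (λ c → ι c ≈ 𝟘) ×
    Σ Basis (λ c → ι c ≈ ⊤) ×
    (∀ a b → Σ Basis (λ c → ι c ≈ ι a ∧ ι b)) ×
    (∀ a b → Σ Basis (λ c → ι c ≈ ι a ∨ ι b)) ×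
    (∀ a → Σ Basis (λ c → ι c ≈ (ι a) *))

-- Continuous maps f : L → M, given by f⁻ : B_M → L

record ContMap (L M : Locale) : Set₁ where
  private
    module L = Locale L
    module M = Locale M
  field
    f⁻        : M.Basis → L.Carrier
    pres-top  : L.⊤ L.≈ L.⋁ M.Basis f⁻
    pres-meet : ∀ a b → (f⁻ a L.∧ f⁻ b) L.≈
                  L.⋁ (Σ M.Basis (λ c → (M.ι c M.≤ M.ι a) × (M.ι c M.≤ M.ι b)))
                      (λ p → f⁻ (proj₁ p))
    pres-cov  : ∀ a (U : Set) (u : U → M.Basis) →
                M.ι a M.≤ M.⋁ U (λ k → M.ι (u k)) →
                f⁻ a L.≤ L.⋁ U (λ k → f⁻ (u k))

-- Strong inclusion on a subset P (a predicate) of a locale L.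
-- A "set-relation" is rendered as a Set-valued (small) relation.

module _ (L : Locale) where
  open Locale L

  record IsStrongInclusion (P : Carrier → Set) (_◁_ : Carrier → Carrier → Set) : Set₁ where
    field
      inP   : ∀ {x y} → x ◁ y → P x × P y
      cond1 : (𝟘 ◁ 𝟘) × (⊤ ◁ ⊤)
      cond2 : ∀ {x a b y} → P x → P y → x ≤ a → a ◁ b → b ≤ y → x ◁ y
      cond3 : ∀ {x a b} → x ◁ a → x ◁ b → x ◁ (a ∧ b)
      cond4 : ∀ {x y a} → x ◁ a → y ◁ a → (x ∨ y) ◁ a
      cond5 : ∀ {a b} → a ◁ b → (b *) ◁ (a *)
      cond6 : ∀ {x y} → x ◁ y → x ≺ y
      cond7 : ∀ {x y} → x ◁ y → Σ Carrier (λ z → P z × (x ◁ z) × (z ◁ y))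

-- The construction of Lemma 4.4.
-- S = {s j : j ∈ J} ⊆ L,  F = {f i : L → Ls i}_{i ∈ I}.

module Construction (L : Locale) (J : Set) (s : J → Locale.Carrier L)
                    (I : Set) (Ls : I → Locale) (f : (i : I) → ContMap L (Ls i)) where
  open Locale L

  fm : (i : I) → Locale.Basis (Ls i) → Carrier
  fm i = ContMap.f⁻ (f i)

  -- S_F^* : terms generated from S_F = S ∪ {f_i⁻(b)} by 0,1,∧,∨,*
  data Tm : Set where
    sT   : J → Tm
    fT   : (i : I) → Locale.Basis (Ls i) → Tm
    0T   : Tm
    1T   : Tm
    _∧T_ : Tm → Tm → Tm
    _∨T_ : Tm → Tm → Tm
    _*T  : Tm → Tm

  ⟦_⟧ : Tm → Carrier
  ⟦ sT j ⟧    = s j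
  ⟦ fT i b ⟧  = fm i b
  ⟦ 0T ⟧      = 𝟘
  ⟦ 1T ⟧      = ⊤
  ⟦ t ∧T u ⟧  = ⟦ t ⟧ ∧ ⟦ u ⟧
  ⟦ t ∨T u ⟧  = ⟦ t ⟧ ∨ ⟦ u ⟧
  ⟦ t *T ⟧    = ⟦ t ⟧ *

  SF* : Carrier → Set
  SF* x = Σ Tm (λ t → x ≈ ⟦ t ⟧)

  data _◁T_ : Tm → Tm → Set where
    base  : ∀ i (a b : Locale.Basis (Ls i)) →
            Locale._≺_ (Ls i) (Locale.ι (Ls i) b) (Locale.ι (Ls i) a) →
            fT i b ◁T fT i a
    c1-0  : 0T ◁T 0T
    c1-1  : 1T ◁T 1T
    c2    : ∀ {x a b y} → ⟦ x ⟧ ≤ ⟦ a ⟧ → a ◁T b → ⟦ b ⟧ ≤ ⟦ y ⟧ → x ◁T y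
    c3    : ∀ {x a b} → x ◁T a → x ◁T b → x ◁T (a ∧T b)
    c4    : ∀ {x y a} → x ◁T a → y ◁T a → (x ∨T y) ◁T a
    c5    : ∀ {a b} → a ◁T b → (b *T) ◁T (a *T)

  _◁F_ : Carrier → Carrier → Set
  x ◁F y = Σ Tm (λ t → Σ Tm (λ u → (x ≈ ⟦ t ⟧) × (y ≈ ⟦ u ⟧) × (t ◁T u)))

-- The generating pairs f⁻(b) ◁ f⁻(a) are well inside because continuous maps preserve ≺
-- on basic elements, and ≺ satisfies (1)–(5), so by induction ◁_F ⊆ ≺.  Interpolation
-- (7) is also proved by induction on the derivation: each closure rule transports an
-- interpolant, and for a generator it suffices to interpolate b ≺ a inside Lᵢ itself.
-- There compactness and regularity do the work: 1 = a ∨ b* is covered by the basic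
-- c ≺ a together with the basic e disjoint from b; a finite subcover and closure of the
-- basis under finite joins give one basic c ≺ a with 1 = c ∨ b*, i.e. b ≺ c ≺ a.
module Submission where

open import Defs
open import Data.Empty using (⊥)
open import Data.Unit using (tt) renaming (⊤ to Unit)
open import Data.Bool using (true; false)
open import Data.Nat using (zero; suc)
open import Data.Fin using (Fin; zero; suc)
open import Data.Sum using (_⊎_; inj₁; inj₂; [_,_])
open import Data.Product using (Σ; _×_; _,_; proj₁; proj₂)
open import Function using (_∘_; const)
import Relation.Binary.Reasoning.Base.Single as SingleReasoning
open import Relation.Binary.Reasoning.Syntax using (module ≤-syntax)

module LocaleProperties (L : Locale) where
  open Locale L

  module ≤-Reasoning where
    open SingleReasoning _≤_ ≤-refl ≤-trans public using (begin_; _∎)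
    open SingleReasoning _≤_ ≤-refl ≤-trans using (_IsRelatedTo_; ∼-go)
    open ≤-syntax _IsRelatedTo_ _IsRelatedTo_ ∼-go public

  open ≤-Reasoning

  ≈-refl : ∀ {x} → x ≈ x
  ≈-refl = ≤-refl , ≤-refl

  𝟘≤ : ∀ {x} → 𝟘 ≤ x
  𝟘≤ = ⋁-lub _ (λ ())

  x≤x∨y : ∀ {x y} → x ≤ x ∨ y
  x≤x∨y = ⋁-ub _ true

  y≤x∨y : ∀ {x y} → y ≤ x ∨ y
  y≤x∨y = ⋁-ub _ false

  ∨-lub : ∀ {x y z} → x ≤ z → y ≤ z → x ∨ y ≤ z
  ∨-lub p q = ⋁-lub _ (λ { true → p ; false → q })

  ∨-mono : ∀ {x y x′ y′} → x ≤ x′ → y ≤ y′ → x ∨ y ≤ x′ ∨ y′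
  ∨-mono p q = ∨-lub (≤-trans p x≤x∨y) (≤-trans q y≤x∨y)

  ∨-comm : ∀ {x y} → x ∨ y ≤ y ∨ x
  ∨-comm = ∨-lub y≤x∨y x≤x∨y

  ∧-mono : ∀ {x y x′ y′} → x ≤ x′ → y ≤ y′ → x ∧ y ≤ x′ ∧ y′
  ∧-mono p q = ∧-glb (≤-trans ∧-lb₁ p) (≤-trans ∧-lb₂ q)

  ∧-comm : ∀ {x y} → x ∧ y ≤ y ∧ x
  ∧-comm = ∧-glb ∧-lb₂ ∧-lb₁

  ∧-cong : ∀ {x y x′ y′} → x ≈ x′ → y ≈ y′ → x ∧ y ≈ x′ ∧ y′
  ∧-cong p q = ∧-mono (proj₁ p) (proj₁ q) , ∧-mono (proj₂ p) (proj₂ q)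

  ∨-cong : ∀ {x y x′ y′} → x ≈ x′ → y ≈ y′ → x ∨ y ≈ x′ ∨ y′
  ∨-cong p q = ∨-mono (proj₁ p) (proj₁ q) , ∨-mono (proj₂ p) (proj₂ q)

  ∧-distribˡ-∨ : ∀ {x y z} → x ∧ (y ∨ z) ≤ (x ∧ y) ∨ (x ∧ z)
  ∧-distribˡ-∨ {x} = ≤-trans (distrib x _) (⋁-lub _ (λ { true → x≤x∨y ; false → y≤x∨y }))

  ∨-distribˡ-∧ : ∀ {x y z} → (x ∨ y) ∧ (x ∨ z) ≤ x ∨ (y ∧ z)
  ∨-distribˡ-∧ {x} {y} {z} = begin
    (x ∨ y) ∧ (x ∨ z)                   ≤⟨ ∧-distribˡ-∨ ⟩
    ((x ∨ y) ∧ x) ∨ ((x ∨ y) ∧ z)       ≤⟨ ∨-mono ∧-lb₂ ∧-comm ⟩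
    x ∨ (z ∧ (x ∨ y))                   ≤⟨ ∨-mono ≤-refl ∧-distribˡ-∨ ⟩
    x ∨ ((z ∧ x) ∨ (z ∧ y))             ≤⟨ ∨-lub x≤x∨y (∨-lub (≤-trans ∧-lb₂ x≤x∨y)
                                                               (≤-trans ∧-comm y≤x∨y)) ⟩
    x ∨ (y ∧ z)                         ∎

  ∨-≤-⋁⊎ : ∀ {x y U V} {u : U → Basis} {v : V → Basis} →
           x ≤ ⋁ U (ι ∘ u) → y ≤ ⋁ V (ι ∘ v) → x ∨ y ≤ ⋁ (U ⊎ V) (ι ∘ [ u , v ])
  ∨-≤-⋁⊎ p q = ∨-lub (≤-trans p (⋁-lub _ (λ k → ⋁-ub _ (inj₁ k))))
                     (≤-trans q (⋁-lub _ (λ k → ⋁-ub _ (inj₂ k))))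

  ∧≤𝟘⇒≤* : ∀ {z y} → z ∧ y ≤ 𝟘 → z ≤ y *
  ∧≤𝟘⇒≤* {z} h = ≤-trans (basis z)
    (⋁-lub _ (λ { (e , e≤z) → ⋁-ub _ (e , ≤-trans (∧-mono e≤z ≤-refl) h , 𝟘≤) }))

  *∧≤𝟘 : ∀ {y} → y * ∧ y ≤ 𝟘
  *∧≤𝟘 {y} = ≤-trans ∧-comm (≤-trans (distrib y _)
    (⋁-lub _ (λ { (c , c∧y≈𝟘) → ≤-trans ∧-comm (proj₁ c∧y≈𝟘) })))

  *-antitone : ∀ {y y′} → y ≤ y′ → y′ * ≤ y *
  *-antitone h = ∧≤𝟘⇒≤* (≤-trans (∧-mono ≤-refl h) *∧≤𝟘)

  *-cong : ∀ {y y′} → y ≈ y′ → y * ≈ y′ *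
  *-cong p = *-antitone (proj₂ p) , *-antitone (proj₁ p)

  ≤** : ∀ {y} → y ≤ y * *
  ≤** = ∧≤𝟘⇒≤* (≤-trans ∧-comm *∧≤𝟘)

  *∧*≤∨* : ∀ {x y} → x * ∧ y * ≤ (x ∨ y) *
  *∧*≤∨* = ∧≤𝟘⇒≤* (≤-trans ∧-distribˡ-∨ (∨-lub (≤-trans (∧-mono ∧-lb₁ ≤-refl) *∧≤𝟘)
                                                (≤-trans (∧-mono ∧-lb₂ ≤-refl) *∧≤𝟘)))

  ⊤≤⇒≺ : ∀ {x y} → ⊤ ≤ x ∨ y * → y ≺ x
  ⊤≤⇒≺ p = p , ⊤-max

  𝟘≺ : ∀ {x} → 𝟘 ≺ x
  𝟘≺ = ⊤≤⇒≺ (≤-trans (∧≤𝟘⇒≤* ∧-lb₂) y≤x∨y)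

  ⊤≺⊤ : ⊤ ≺ ⊤
  ⊤≺⊤ = ⊤≤⇒≺ x≤x∨y

  ≤-≺-≤-trans : ∀ {x a b y} → x ≤ a → a ≺ b → b ≤ y → x ≺ y
  ≤-≺-≤-trans x≤a a≺b b≤y = ⊤≤⇒≺ (≤-trans (proj₁ a≺b) (∨-mono b≤y (*-antitone x≤a)))

  ≺-∧ : ∀ {x a b} → x ≺ a → x ≺ b → x ≺ a ∧ b
  ≺-∧ {x} {a} {b} x≺a x≺b = ⊤≤⇒≺ (begin
    ⊤                            ≤⟨ ∧-glb (proj₁ x≺a) (proj₁ x≺b) ⟩
    (a ∨ x *) ∧ (b ∨ x *)        ≤⟨ ∧-mono ∨-comm ∨-comm ⟩
    (x * ∨ a) ∧ (x * ∨ b)        ≤⟨ ∨-distribˡ-∧ ⟩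
    x * ∨ (a ∧ b)                ≤⟨ ∨-comm ⟩
    (a ∧ b) ∨ x *                ∎)

  ≺-∨ : ∀ {x y a} → x ≺ a → y ≺ a → x ∨ y ≺ a
  ≺-∨ {x} {y} {a} x≺a y≺a = ⊤≤⇒≺ (begin
    ⊤                            ≤⟨ ∧-glb (proj₁ x≺a) (proj₁ y≺a) ⟩
    (a ∨ x *) ∧ (a ∨ y *)        ≤⟨ ∨-distribˡ-∧ ⟩
    a ∨ (x * ∧ y *)              ≤⟨ ∨-mono ≤-refl *∧*≤∨* ⟩
    a ∨ (x ∨ y) *                ∎)

  ≺-* : ∀ {a b} → a ≺ b → b * ≺ a *
  ≺-* a≺b = ⊤≤⇒≺ (≤-trans (proj₁ a≺b) (≤-trans (∨-mono ≤** ≤-refl) ∨-comm))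

  BasisInterpolates : Set
  BasisInterpolates = ∀ {a b} → ι b ≺ ι a → Σ Basis (λ c → ι b ≺ ι c × ι c ≺ ι a)

module ContMapProperties {L M : Locale} (F : ContMap L M) where
  open Locale L
  open LocaleProperties L
  private
    module M = Locale M
    module MP = LocaleProperties M
  open ContMap F

  f⁻-≤-of-cover : ∀ {d x} (U : Set) (u : U → M.Basis) →
                  M.ι d M.≤ M.⋁ U (M.ι ∘ u) → (∀ k → f⁻ (u k) ≤ x) → f⁻ d ≤ x
  f⁻-≤-of-cover {d} U u cover bound = ≤-trans (pres-cov d U u cover) (⋁-lub _ bound)

  f⁻-disjoint : ∀ {e b} → M.ι e M.∧ M.ι b M.≤ M.𝟘 → f⁻ e ∧ f⁻ b ≤ 𝟘
  f⁻-disjoint {e} {b} h = ≤-trans (proj₁ (pres-meet e b))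
    (⋁-lub _ (λ { (d , d≤e , d≤b) →
      f⁻-≤-of-cover ⊥ (λ ()) (M.≤-trans (M.∧-glb d≤e d≤b) (M.≤-trans h (M.⋁-lub _ (λ ()))))
                    (λ ()) }))

  -- Every basic d is covered by a together with the basic e disjoint from b, and f⁻
  -- sends those e into (f⁻ b)*; since the f⁻ d cover ⊤, this gives ⊤ ≤ f⁻ a ∨ (f⁻ b)*.
  f⁻-pres-≺ : ∀ {a b} → M.ι b M.≺ M.ι a → f⁻ b ≺ f⁻ a
  f⁻-pres-≺ {a} {b} b≺a =
    ⊤≤⇒≺ (≤-trans (proj₁ pres-top) (⋁-lub _ (λ d → f⁻-≤-of-cover U u (cover d) bound)))
    where
      U : Set
      U = Unit ⊎ Σ M.Basis (λ e → M.ι e M.∧ M.ι b M.≈ M.𝟘)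
      u : U → M.Basis
      u = [ const a , proj₁ ]
      cover : ∀ d → M.ι d M.≤ M.⋁ U (M.ι ∘ u)
      cover d = M.≤-trans M.⊤-max (M.≤-trans (proj₁ b≺a) (MP.∨-≤-⋁⊎ (M.⋁-ub _ tt) M.≤-refl))
      bound : ∀ k → f⁻ (u k) ≤ f⁻ a ∨ f⁻ b *
      bound (inj₁ _) = x≤x∨y
      bound (inj₂ (e , e∧b≈𝟘)) = ≤-trans (∧≤𝟘⇒≤* (f⁻-disjoint (proj₁ e∧b≈𝟘))) y≤x∨y

module Interpolation (M : Locale) where
  open Locale M
  open LocaleProperties M

  module _ (𝟘ᴮ : Σ Basis (λ c → ι c ≈ 𝟘))
           (∨ᴮ : ∀ a b → Σ Basis (λ c → ι c ≈ ι a ∨ ι b)) where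

    𝟘ᴮ≺ : ∀ {x} → ι (proj₁ 𝟘ᴮ) ≺ x
    𝟘ᴮ≺ = ≤-≺-≤-trans (proj₁ (proj₂ 𝟘ᴮ)) 𝟘≺ ≤-refl

    ≺-upperBound : ∀ {a c₁ c₂} → ι c₁ ≺ ι a → ι c₂ ≺ ι a →
                   Σ Basis (λ c → ι c ≺ ι a × ι c₁ ≤ ι c × ι c₂ ≤ ι c)
    ≺-upperBound {c₁ = c₁} {c₂} c₁≺a c₂≺a =
      let (c , c≈c₁∨c₂) = ∨ᴮ c₁ c₂ in
      c , ≤-≺-≤-trans (proj₁ c≈c₁∨c₂) (≺-∨ c₁≺a c₂≺a) ≤-refl ,
      ≤-trans x≤x∨y (proj₂ c≈c₁∨c₂) , ≤-trans y≤x∨y (proj₂ c≈c₁∨c₂)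

    finite-⋁-≤-≺∨ : ∀ {a x} n (g : Fin n → Carrier) →
                    (∀ j → Σ Basis (λ c → ι c ≺ ι a × g j ≤ ι c ∨ x)) →
                    Σ Basis (λ c → ι c ≺ ι a × ⋁ (Fin n) g ≤ ι c ∨ x)
    finite-⋁-≤-≺∨ zero g _ = proj₁ 𝟘ᴮ , 𝟘ᴮ≺ , ⋁-lub _ (λ ())
    finite-⋁-≤-≺∨ (suc n) g bound =
      let (c₀ , c₀≺a , g₀≤) = bound zero
          (c′ , c′≺a , rest≤) = finite-⋁-≤-≺∨ n (g ∘ suc) (bound ∘ suc)
          (c , c≺a , c₀≤c , c′≤c) = ≺-upperBound c₀≺a c′≺a
      in c , c≺a , ⋁-lub _ (λ
           { zero    → ≤-trans g₀≤ (∨-mono c₀≤c ≤-refl)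
           ; (suc j) → ≤-trans (⋁-ub (g ∘ suc) j) (≤-trans rest≤ (∨-mono c′≤c ≤-refl)) })

    interpolate : IsCompact → IsRegular → BasisInterpolates
    interpolate compact regular {a} {b} b≺a =
      let (n , pick , ⊤≈subcover) = compact U u cover
          (c , c≺a , subcover≤) = finite-⋁-≤-≺∨ n (ι ∘ u ∘ pick) (member-bound ∘ pick)
      in c , ⊤≤⇒≺ (≤-trans (proj₁ ⊤≈subcover) subcover≤) , c≺a
      where
        U : Set
        U = Σ Basis (λ c → ι c ≺ ι a) ⊎ Σ Basis (λ e → ι e ∧ ι b ≈ 𝟘)
        u : U → Basis
        u = [ proj₁ , proj₁ ]
        cover : ⊤ ≈ ⋁ U (ι ∘ u)
        cover = ≤-trans (proj₁ b≺a) (∨-≤-⋁⊎ (proj₁ (regular a)) ≤-refl) , ⊤-max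
        member-bound : ∀ k → Σ Basis (λ c → ι c ≺ ι a × ι (u k) ≤ ι c ∨ ι b *)
        member-bound (inj₁ (c , c≺a)) = c , c≺a , x≤x∨y
        member-bound (inj₂ p) = proj₁ 𝟘ᴮ , 𝟘ᴮ≺ , ≤-trans (⋁-ub _ p) y≤x∨y

module ConstructionProperties (L : Locale) (J : Set) (s : J → Locale.Carrier L)
         (I : Set) (Ls : I → Locale) (f : (i : I) → ContMap L (Ls i)) where
  open Locale L
  open LocaleProperties L
  open Construction L J s I Ls f

  ◁T⇒≺ : ∀ {t u} → t ◁T u → ⟦ t ⟧ ≺ ⟦ u ⟧
  ◁T⇒≺ (base i a b b≺a) = ContMapProperties.f⁻-pres-≺ (f i) b≺a
  ◁T⇒≺ c1-0             = 𝟘≺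
  ◁T⇒≺ c1-1             = ⊤≺⊤
  ◁T⇒≺ (c2 x≤a a◁b b≤y) = ≤-≺-≤-trans x≤a (◁T⇒≺ a◁b) b≤y
  ◁T⇒≺ (c3 x◁a x◁b)     = ≺-∧ (◁T⇒≺ x◁a) (◁T⇒≺ x◁b)
  ◁T⇒≺ (c4 x◁a y◁a)     = ≺-∨ (◁T⇒≺ x◁a) (◁T⇒≺ y◁a)
  ◁T⇒≺ (c5 a◁b)         = ≺-* (◁T⇒≺ a◁b)

  ◁T-interpolate : (∀ i → LocaleProperties.BasisInterpolates (Ls i)) →
                   ∀ {t u} → t ◁T u → Σ Tm (λ z → t ◁T z × z ◁T u)
  ◁T-interpolate interp (base i a b b≺a) =
    let (c , b≺c , c≺a) = interp i b≺a in fT i c , base i c b b≺c , base i a c c≺a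
  ◁T-interpolate interp c1-0 = 0T , c1-0 , c1-0
  ◁T-interpolate interp c1-1 = 1T , c1-1 , c1-1
  ◁T-interpolate interp (c2 x≤a a◁b b≤y) =
    let (z , a◁z , z◁b) = ◁T-interpolate interp a◁b in
    z , c2 x≤a a◁z ≤-refl , c2 ≤-refl z◁b b≤y
  ◁T-interpolate interp (c3 x◁a x◁b) =
    let (z , x◁z , z◁a) = ◁T-interpolate interp x◁a
        (z′ , x◁z′ , z′◁b) = ◁T-interpolate interp x◁b
    in z ∧T z′ , c3 x◁z x◁z′ , c3 (c2 ∧-lb₁ z◁a ≤-refl) (c2 ∧-lb₂ z′◁b ≤-refl)
  ◁T-interpolate interp (c4 x◁a y◁a) =
    let (z , x◁z , z◁a) = ◁T-interpolate interp x◁a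
        (z′ , y◁z′ , z′◁a) = ◁T-interpolate interp y◁a
    in z ∨T z′ , c4 (c2 ≤-refl x◁z x≤x∨y) (c2 ≤-refl y◁z′ y≤x∨y) , c4 z◁a z′◁a
  ◁T-interpolate interp (c5 a◁b) =
    let (z , a◁z , z◁b) = ◁T-interpolate interp a◁b in z *T , c5 z◁b , c5 a◁z

  ≤-◁F-≤-trans : ∀ {x a b y} → SF* x → SF* y → x ≤ a → a ◁F b → b ≤ y → x ◁F y
  ≤-◁F-≤-trans (tx , x≈) (ty , y≈) x≤a (t , u , a≈ , b≈ , t◁u) b≤y =
    tx , ty , x≈ , y≈ ,
    c2 (≤-trans (proj₂ x≈) (≤-trans x≤a (proj₁ a≈))) t◁u
       (≤-trans (proj₂ b≈) (≤-trans b≤y (proj₁ y≈)))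

  ◁F-∧ : ∀ {x a b} → x ◁F a → x ◁F b → x ◁F (a ∧ b)
  ◁F-∧ (t , u , x≈ , a≈ , t◁u) (t′ , u′ , x≈′ , b≈ , t′◁u′) =
    t , u ∧T u′ , x≈ , ∧-cong a≈ b≈ , c3 t◁u (c2 (≤-trans (proj₂ x≈) (proj₁ x≈′)) t′◁u′ ≤-refl)

  ◁F-∨ : ∀ {x y a} → x ◁F a → y ◁F a → (x ∨ y) ◁F a
  ◁F-∨ (t , u , x≈ , a≈ , t◁u) (t′ , u′ , y≈ , a≈′ , t′◁u′) =
    t ∨T t′ , u , ∨-cong x≈ y≈ , a≈ , c4 t◁u (c2 ≤-refl t′◁u′ (≤-trans (proj₂ a≈′) (proj₁ a≈)))

  ◁F-* : ∀ {a b} → a ◁F b → (b *) ◁F (a *)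
  ◁F-* (t , u , a≈ , b≈ , t◁u) = u *T , t *T , *-cong b≈ , *-cong a≈ , c5 t◁u

  ◁F⇒≺ : ∀ {x y} → x ◁F y → x ≺ y
  ◁F⇒≺ (t , u , x≈ , y≈ , t◁u) = ≤-≺-≤-trans (proj₁ x≈) (◁T⇒≺ t◁u) (proj₂ y≈)

  ◁F-interpolate : (∀ i → LocaleProperties.BasisInterpolates (Ls i)) →
                   ∀ {x y} → x ◁F y → Σ Carrier (λ z → SF* z × x ◁F z × z ◁F y)
  ◁F-interpolate interp (t , u , x≈ , y≈ , t◁u) =
    let (z , t◁z , z◁u) = ◁T-interpolate interp t◁u in
    ⟦ z ⟧ , (z , ≈-refl) , (t , z , x≈ , ≈-refl , t◁z) , (z , u , ≈-refl , y≈ , z◁u)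

lemma4p4 : (L : Locale) (J : Set) (s : J → Locale.Carrier L)
           (I : Set) (Ls : I → Locale) (f : (i : I) → ContMap L (Ls i)) →
           (∀ i → Locale.IsCompact (Ls i)) →
           (∀ i → Locale.IsRegular (Ls i)) →
           (∀ i → Locale.BasisIsSubPcd (Ls i)) →
           IsStrongInclusion L (Construction.SF* L J s I Ls f) (Construction._◁F_ L J s I Ls f)
lemma4p4 L J s I Ls f compact regular pcd = record
  { inP   = λ { (t , u , x≈ , y≈ , _) → (t , x≈) , (u , y≈) }
  ; cond1 = (0T , 0T , ≈-refl , ≈-refl , c1-0) , (1T , 1T , ≈-refl , ≈-refl , c1-1)
  ; cond2 = ≤-◁F-≤-trans
  ; cond3 = ◁F-∧
  ; cond4 = ◁F-∨
  ; cond5 = ◁F-*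
  ; cond6 = ◁F⇒≺
  ; cond7 = ◁F-interpolate interp
  }
  where
    open LocaleProperties L using (≈-refl)
    open Construction L J s I Ls f
    open ConstructionProperties L J s I Ls f
    interp : ∀ i → LocaleProperties.BasisInterpolates (Ls i)
    interp i = let (𝟘ᴮ , _ , _ , ∨ᴮ , _) = pcd i in
      Interpolation.interpolate (Ls i) 𝟘ᴮ ∨ᴮ (compact i) (regular i)
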